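{- Let $L$ be a finite set of list items and let ${A}$ be a deterministic projective list update algorithm on $L$ (with a fixed initial list state), described by its state function $S$. Let $x\neq y$ be items and $i,j\ge 0$. Suppose $|R(x^i)|=1$ and $|R(y^j)|=1$, and suppose that for some $\lambda\in\mathrm{perm}(x^iy^j)$ the requests $x_{(q)},y_{(l)}$ form an agile pair of $\lambda$. Then for every $\sigma\in\mathrm{perm}(x^iy^j)$ in which $x_{(q)}$ and $y_{(l)}$ are adjacent, swapping $x_{(q)}$ and $y_{(l)}$ changes $S_{xy}(\sigma)$.
   Context: List update problem: a list state is a linear order of the finite item set $L$, written $[x_1\ldots x_n]$ with $x_1$ at the front. A request sequence is a finite word over $L$. A deterministic algorithm with fixed initial list is identified with the function $S$ mapping each finite request sequence $\sigma$ to the list state $S(\sigma)$ after serving $\sigma$. For items $x,y$, $\sigma_{xy}$ (resp. $\sigma_x$) is the subsequence of $\sigma$ of requests to $x$ or $y$ (resp. to $x$), and $S_{xy}(\sigma)\in\{[xy],[yx]\}$ is the relative order of $x,y$ in $S(\sigma)$. The algorithm is projective if $S_{xy}(\sigma)=S_{xy}(\sigma_{xy})$ for all $x,y,\sigma$. $x^i$ denotes the sequence of $i$ requests to $x$; if $\sigma_x=x^i$, $x_{(q)}$ denotes the $q$th request to $x$ in $\sigma$. $\mathrm{perm}(x^iy^j)$ is the set of all request sequences with exactly $i$ requests to $x$ and $j$ requests to $y$. Requests $x_{(q)},y_{(l)}$ form an agile pair of $\sigma$ if they are adjacent in $\sigma$ and swapping them changes $S_{xy}(\sigma)$. $R(x^i)$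 is the set of requests $x_{(q)}$ ($1\le q\le i$) for which there exist an item $y$, an index $l$ and a request sequence $\sigma$ with $\sigma_x=x^i$ such that $x_{(q)},y_{(l)}$ is an agile pair of $\sigma$. -}

module Defs where

open import Data.Nat using (ℕ; suc; _≤_)
open import Data.Nat.Base using (_<ᵇ_)
open import Data.Fin using (Fin; toℕ; _≟_)
open import Data.Fin.Permutation using (Permutation′; _⟨$⟩ˡ_)
open import Data.List using (List; []; _∷_; _++_; filter; length)
open import Data.Bool using (Bool)
open import Data.Product using (Σ; ∃; _×_; _,_)
open import Data.Sum using (_⊎_)
open import Relation.Binary.PropositionalEquality using (_≡_; _≢_)
open import Relation.Nullary.Decidable using (_⊎-dec_)
open import Data.List.Relation.Unary.All using (All)

Item : ℕ → Set
Item n = Fin n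

-- A list state is a linear order of the items, given as a permutation
-- π : positions ↔ items; π ⟨$⟩ʳ k is the item at position k (0 = front).
ListState : ℕ → Set
ListState n = Permutation′ n

pos : ∀ {n} → ListState n → Item n → Fin n
pos π x = π ⟨$⟩ˡ x

ReqSeq : ℕ → Set
ReqSeq n = List (Item n)

-- A deterministic algorithm (with fixed initial list S []) is identified
-- with its state function.
Algorithm : ℕ → Set
Algorithm n = ReqSeq n → ListState n

-- Relative order S_xy(σ): true means [xy] (x before y), false means [yx].
Sxy : ∀ {n} → Algorithm n → ReqSeq n → Item n → Item n → Bool
Sxy S σ x y = toℕ (pos (S σ) x) <ᵇ toℕ (pos (S σ) y)

occ : ∀ {n} → Item n → ReqSeq n → ℕ
occ x σ = length (filter (_≟ x) σ)

proj : ∀ {n} → Item n → Item n → ReqSeq n → ReqSeq n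
proj x y σ = filter (λ z → (z ≟ x) ⊎-dec (z ≟ y)) σ

Projective : ∀ {n} → Algorithm n → Set
Projective S = ∀ x y σ → Sxy S σ x y ≡ Sxy S (proj x y σ) x y

-- σ' is obtained from σ by swapping the adjacent requests x_(q) and y_(l)
-- (1-based indices: x_(q) is the q-th request to x in σ).
-- The pair is adjacent in σ in either order.
AdjSwap : ∀ {n} → ReqSeq n → ReqSeq n → Item n → ℕ → Item n → ℕ → Set
AdjSwap σ σ' x q y l =
  Σ _ λ α → Σ _ λ β →
    suc (occ x α) ≡ q × suc (occ y α) ≡ l ×
    ((σ ≡ α ++ x ∷ y ∷ β × σ' ≡ α ++ y ∷ x ∷ β)
     ⊎ (σ ≡ α ++ y ∷ x ∷ β × σ' ≡ α ++ x ∷ y ∷ β))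

AgilePair : ∀ {n} → Algorithm n → ReqSeq n → Item n → ℕ → Item n → ℕ → Set
AgilePair S σ x q y l =
  Σ _ λ σ' → AdjSwap σ σ' x q y l × Sxy S σ x y ≢ Sxy S σ' x y

InR : ∀ {n} → Algorithm n → Item n → ℕ → ℕ → Set
InR S x i q = 1 ≤ q × q ≤ i ×
  Σ _ λ y → Σ ℕ λ l → Σ _ λ σ → occ x σ ≡ i × AgilePair S σ x q y l

CardR≡1 : ∀ {n} → Algorithm n → Item n → ℕ → Set
CardR≡1 S x i = Σ ℕ λ q → InR S x i q × (∀ q' → InR S x i q' → q' ≡ q)

InPerm : ∀ {n} → Item n → ℕ → Item n → ℕ → ReqSeq n → Set
InPerm x i y j σ = All (λ z → z ≡ x ⊎ z ≡ y) σ × occ x σ ≡ i × occ y σ ≡ j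

-- Encode requests over {x, y} as Boolean words.  Swapping the adjacent requests
-- x_(m+1) and y_(k+1) is then the swap xy ↔ yx behind a prefix with m x's and k y's.
-- If such a swap changes S_xy in a word of perm(x^i y^j), then x_(m+1) ∈ R(x^i) and
-- y_(k+1) ∈ R(y^j); as both sets are singletons, the agile pair of λ pins the only
-- prefix at which a swap can change S_xy.  Bubble sort never has to perform that
-- swap, so S_xy takes the value at x^i y^j on every word in which x_(q) precedes
-- y_(l), and the value at y^j x^i on every other word.  Since the swap at λ changes
-- S_xy, these two values differ, and so every swap of x_(q) and y_(l) changes S_xy.
module Submission where

open import Data.Bool using (Bool; true; false; not)
open import Data.Bool.Properties using (not-injective) renaming (_≟_ to _≟ᵇ_)
open import Data.Empty using (⊥-elim)
open import Data.Fin using (_≟_)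
open import Data.Fin.Properties using (toℕ-injective)
open import Data.Fin.Permutation using (_⟨$⟩ʳ_; inverseʳ)
open import Data.List using (List; []; _∷_; _++_; map; length; replicate)
open import Data.List.Properties using (map-++; filter-accept; filter-reject)
open import Data.List.Relation.Unary.All using (All; []; _∷_)
open import Data.List.Relation.Unary.All.Properties using (++⁻)
open import Data.Nat using (ℕ; zero; suc; _+_; _<_; _≤_; _<ᵇ_; s≤s; z≤n)
open import Data.Nat.Properties using (+-suc; suc-injective)
open import Data.Product using (Σ; _×_; _,_; proj₁; proj₂; map₁; map₂; uncurry; swap)
open import Data.Sum using (_⊎_; inj₁; inj₂)
open import Function using (_∘_; _⇔_; mk⇔; Equivalence)
open import Relation.Nullary.Decidable using (decidable-stable)
open import Relation.Binary.PropositionalEquality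

open import Defs

-- true encodes x and false encodes y.
#x #y : List Bool → ℕ
#x [] = 0
#x (true ∷ w) = suc (#x w)
#x (false ∷ w) = #x w
#y [] = 0
#y (true ∷ w) = #y w
#y (false ∷ w) = suc (#y w)

counts : List Bool → ℕ × ℕ
counts w = #x w , #y w

xy yx : List Bool → List Bool → List Bool
xy a b = a ++ true ∷ false ∷ b
yx a b = a ++ false ∷ true ∷ b

x^_y^_ y^_x^_ : ℕ → ℕ → List Bool
x^ i y^ j = replicate i true ++ replicate j false
y^ j x^ i = replicate j false ++ replicate i true

yx-inversions xy-inversions : List Bool → ℕ
yx-inversions [] = 0
yx-inversions (true ∷ w) = yx-inversions w
yx-inversions (false ∷ w) = #x w + yx-inversions w
xy-inversions [] = 0
xy-inversions (true ∷ w) = #y w + xy-inversions w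
xy-inversions (false ∷ w) = xy-inversions w

-- x-before-y w (m , k): the (m+1)-th x of w occurs before the (k+1)-th y of w.
x-before-y : List Bool → ℕ × ℕ → Bool
x-before-y [] p = false
x-before-y (true ∷ w) (zero , k) = true
x-before-y (true ∷ w) (suc m , k) = x-before-y w (m , k)
x-before-y (false ∷ w) (m , zero) = false
x-before-y (false ∷ w) (m , suc k) = x-before-y w (m , k)

counts-swap : ∀ a b → counts (xy a b) ≡ counts (yx a b)
counts-swap [] b = refl
counts-swap (true ∷ a) b = cong (map₁ suc) (counts-swap a b)
counts-swap (false ∷ a) b = cong (map₂ suc) (counts-swap a b)

yx-inversions-swap : ∀ a b → yx-inversions (yx a b) ≡ suc (yx-inversions (xy a b))
yx-inversions-swap [] b = refl
yx-inversions-swap (true ∷ a) b = yx-inversions-swap a b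
yx-inversions-swap (false ∷ a) b = begin
  #x (yx a b) + yx-inversions (yx a b)       ≡⟨ cong₂ _+_ (cong proj₁ (sym (counts-swap a b)))
                                                          (yx-inversions-swap a b) ⟩
  #x (xy a b) + suc (yx-inversions (xy a b)) ≡⟨ +-suc _ _ ⟩
  suc (#x (xy a b) + yx-inversions (xy a b)) ∎
  where open ≡-Reasoning

xy-inversions-swap : ∀ a b → xy-inversions (xy a b) ≡ suc (xy-inversions (yx a b))
xy-inversions-swap [] b = refl
xy-inversions-swap (false ∷ a) b = xy-inversions-swap a b
xy-inversions-swap (true ∷ a) b = begin
  #y (xy a b) + xy-inversions (xy a b)       ≡⟨ cong₂ _+_ (cong proj₂ (counts-swap a b))
                                                          (xy-inversions-swap a b) ⟩
  #y (yx a b) + suc (xy-inversions (yx a b)) ≡⟨ +-suc _ _ ⟩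
  suc (#y (yx a b) + xy-inversions (yx a b)) ∎
  where open ≡-Reasoning

x-before-y-xy : ∀ a b → x-before-y (xy a b) (counts a) ≡ true
x-before-y-xy [] b = refl
x-before-y-xy (true ∷ a) b = x-before-y-xy a b
x-before-y-xy (false ∷ a) b = x-before-y-xy a b

x-before-y-yx : ∀ a b → x-before-y (yx a b) (counts a) ≡ false
x-before-y-yx [] b = refl
x-before-y-yx (true ∷ a) b = x-before-y-yx a b
x-before-y-yx (false ∷ a) b = x-before-y-yx a b

x-before-y-swap : ∀ a b {p} → counts a ≢ p → x-before-y (xy a b) p ≡ x-before-y (yx a b) p
x-before-y-swap [] b {zero , zero} a≢p = ⊥-elim (a≢p refl)
x-before-y-swap [] b {zero , suc k} _ = refl
x-before-y-swap [] b {suc m , zero} _ = refl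
x-before-y-swap [] b {suc m , suc k} _ = refl
x-before-y-swap (true ∷ a) b {zero , k} _ = refl
x-before-y-swap (true ∷ a) b {suc m , k} a≢p = x-before-y-swap a b (a≢p ∘ cong (map₁ suc))
x-before-y-swap (false ∷ a) b {m , zero} _ = refl
x-before-y-swap (false ∷ a) b {m , suc k} a≢p = x-before-y-swap a b (a≢p ∘ cong (map₂ suc))

#x-< : ∀ a b → #x a < #x (xy a b)
#x-< [] b = s≤s z≤n
#x-< (true ∷ a) b = s≤s (#x-< a b)
#x-< (false ∷ a) b = #x-< a b

#y-< : ∀ a b → #y a < #y (xy a b)
#y-< [] b = s≤s z≤n
#y-< (true ∷ a) b = #y-< a b
#y-< (false ∷ a) b = s≤s (#y-< a b)

counts-x^y^ : ∀ i j → counts (x^ i y^ j) ≡ (i , j)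
counts-x^y^ zero zero = refl
counts-x^y^ zero (suc j) = cong (map₂ suc) (counts-x^y^ zero j)
counts-x^y^ (suc i) j = cong (map₁ suc) (counts-x^y^ i j)

counts-y^x^ : ∀ i j → counts (y^ j x^ i) ≡ (i , j)
counts-y^x^ zero zero = refl
counts-y^x^ (suc i) zero = cong (map₁ suc) (counts-y^x^ i zero)
counts-y^x^ i (suc j) = cong (map₂ suc) (counts-y^x^ i j)

Contains-yx Contains-xy : List Bool → Set
Contains-yx w = Σ _ λ a → Σ _ λ b → w ≡ yx a b
Contains-xy w = Σ _ λ a → Σ _ λ b → w ≡ xy a b

contains-yx⊎x^y^ : ∀ w → Contains-yx w ⊎ Σ ℕ λ i → Σ ℕ λ j → w ≡ x^ i y^ j
contains-yx⊎x^y^ [] = inj₂ (0 , 0 , refl)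
contains-yx⊎x^y^ (c ∷ w) with c | contains-yx⊎x^y^ w
... | c     | inj₁ (a , b , refl) = inj₁ (c ∷ a , b , refl)
... | true  | inj₂ (i , j , refl) = inj₂ (suc i , j , refl)
... | false | inj₂ (zero , j , refl) = inj₂ (0 , suc j , refl)
... | false | inj₂ (suc i , j , refl) = inj₁ ([] , x^ i y^ j , refl)

contains-xy⊎y^x^ : ∀ w → Contains-xy w ⊎ Σ ℕ λ i → Σ ℕ λ j → w ≡ y^ j x^ i
contains-xy⊎y^x^ [] = inj₂ (0 , 0 , refl)
contains-xy⊎y^x^ (c ∷ w) with c | contains-xy⊎y^x^ w
... | c     | inj₁ (a , b , refl) = inj₁ (c ∷ a , b , refl)
... | false | inj₂ (i , j , refl) = inj₂ (i , suc j , refl)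
... | true  | inj₂ (i , zero , refl) = inj₂ (suc i , 0 , refl)
... | true  | inj₂ (i , suc j , refl) = inj₁ ([] , y^ j x^ i , refl)

Agile : {A : Set} → (List Bool → A) → List Bool → List Bool → Set
Agile F a b = F (xy a b) ≢ F (yx a b)

module AgileAtOnePrefix {A : Set} (F : List Bool → A) (i j : ℕ) (p : ℕ × ℕ)
  (swap-invariant : ∀ a b → counts (xy a b) ≡ (i , j) → counts a ≢ p →
                    F (xy a b) ≡ F (yx a b)) where

  -- Bubble sort; a swapped yx is never the one behind a prefix with counts p, since
  -- x-before-y stays true.
  sort-x^y^ : ∀ {N} w → yx-inversions w ≡ N → counts w ≡ (i , j) →
              x-before-y w p ≡ true → F w ≡ F (x^ i y^ j)
  sort-x^y^ w _ w-ij _ with contains-yx⊎x^y^ w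
  ... | inj₂ (i′ , j′ , refl) = cong (F ∘ uncurry x^_y^_) (trans (sym (counts-x^y^ i′ j′)) w-ij)
  sort-x^y^ {zero} _ inv≡0 _ _ | inj₁ (a , b , refl)
    with () ← trans (sym (yx-inversions-swap a b)) inv≡0
  sort-x^y^ {suc N} _ inv≡N w-ij before | inj₁ (a , b , refl) =
    trans (sym (swap-invariant a b xy-ij a≢p))
          (sort-x^y^ (xy a b) (suc-injective (trans (sym (yx-inversions-swap a b)) inv≡N))
                     xy-ij (trans (x-before-y-swap a b a≢p) before))
    where
    xy-ij : counts (xy a b) ≡ (i , j)
    xy-ij = trans (counts-swap a b) w-ij
    a≢p : counts a ≢ p
    a≢p refl with () ← trans (sym (x-before-y-yx a b)) before

  sort-y^x^ : ∀ {N} w → xy-inversions w ≡ N → counts w ≡ (i , j) →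
              x-before-y w p ≡ false → F w ≡ F (y^ j x^ i)
  sort-y^x^ w _ w-ij _ with contains-xy⊎y^x^ w
  ... | inj₂ (i′ , j′ , refl) =
    cong (F ∘ uncurry y^_x^_ ∘ swap) (trans (sym (counts-y^x^ i′ j′)) w-ij)
  sort-y^x^ {zero} _ inv≡0 _ _ | inj₁ (a , b , refl)
    with () ← trans (sym (xy-inversions-swap a b)) inv≡0
  sort-y^x^ {suc N} _ inv≡N w-ij before | inj₁ (a , b , refl) =
    trans (swap-invariant a b w-ij a≢p)
          (sort-y^x^ (yx a b) (suc-injective (trans (sym (xy-inversions-swap a b)) inv≡N))
                     (trans (sym (counts-swap a b)) w-ij)
                     (trans (sym (x-before-y-swap a b a≢p)) before))
    where
    a≢p : counts a ≢ p
    a≢p refl with () ← trans (sym (x-before-y-xy a b)) before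

  xy-value : ∀ a b → counts a ≡ p → counts (xy a b) ≡ (i , j) → F (xy a b) ≡ F (x^ i y^ j)
  xy-value a b refl xy-ij = sort-x^y^ (xy a b) refl xy-ij (x-before-y-xy a b)

  yx-value : ∀ a b → counts a ≡ p → counts (xy a b) ≡ (i , j) → F (yx a b) ≡ F (y^ j x^ i)
  yx-value a b refl xy-ij =
    sort-y^x^ (yx a b) refl (trans (sym (counts-swap a b)) xy-ij) (x-before-y-yx a b)

  agile-transfer : ∀ {a₀ b₀ a b} → counts a₀ ≡ p → counts (xy a₀ b₀) ≡ (i , j) → Agile F a₀ b₀ →
                   counts a ≡ p → counts (xy a b) ≡ (i , j) → Agile F a b
  agile-transfer {a₀} {b₀} {a} {b} a₀-p ij₀ agile₀ a-p ij agrees = agile₀ (begin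
    F (xy a₀ b₀)  ≡⟨ xy-value a₀ b₀ a₀-p ij₀ ⟩
    F (x^ i y^ j) ≡⟨ xy-value a b a-p ij ⟨
    F (xy a b)    ≡⟨ agrees ⟩
    F (yx a b)    ≡⟨ yx-value a b a-p ij ⟩
    F (y^ j x^ i) ≡⟨ yx-value a₀ b₀ a₀-p ij₀ ⟨
    F (yx a₀ b₀)  ∎)
    where open ≡-Reasoning

<ᵇ-flip : ∀ m n → m ≢ n → (n <ᵇ m) ≡ not (m <ᵇ n)
<ᵇ-flip zero zero m≢n = ⊥-elim (m≢n refl)
<ᵇ-flip zero (suc n) _ = refl
<ᵇ-flip (suc m) zero _ = refl
<ᵇ-flip (suc m) (suc n) m≢n = <ᵇ-flip m n (m≢n ∘ cong suc)

Sxy-flip : ∀ {n} (S : Algorithm n) σ {x y : Item n} → x ≢ y → Sxy S σ y x ≡ not (Sxy S σ x y)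
Sxy-flip S σ x≢y = <ᵇ-flip _ _ (x≢y ∘ pos-injective ∘ toℕ-injective)
  where
  pos-injective : ∀ {u v} → pos (S σ) u ≡ pos (S σ) v → u ≡ v
  pos-injective eq = trans (sym (inverseʳ (S σ))) (trans (cong (S σ ⟨$⟩ʳ_) eq) (inverseʳ (S σ)))

module Encoding {n} {x y : Item n} (x≢y : x ≢ y) where

  letter : Bool → Item n
  letter true = x
  letter false = y

  encode : List Bool → ReqSeq n
  encode = map letter

  occ-x-encode : ∀ w → occ x (encode w) ≡ #x w
  occ-x-encode [] = refl
  occ-x-encode (true ∷ w) = trans (cong length (filter-accept (_≟ x) refl)) (cong suc (occ-x-encode w))
  occ-x-encode (false ∷ w) = trans (cong length (filter-reject (_≟ x) (x≢y ∘ sym))) (occ-x-encode w)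

  occ-y-encode : ∀ w → occ y (encode w) ≡ #y w
  occ-y-encode [] = refl
  occ-y-encode (true ∷ w) = trans (cong length (filter-reject (_≟ y) x≢y)) (occ-y-encode w)
  occ-y-encode (false ∷ w) = trans (cong length (filter-accept (_≟ y) refl)) (cong suc (occ-y-encode w))

  OverXY : ReqSeq n → Set
  OverXY = All (λ z → z ≡ x ⊎ z ≡ y)

  decode : ∀ {σ} → OverXY σ → Σ _ λ w → σ ≡ encode w
  decode [] = [] , refl
  decode (inj₁ refl ∷ σ-xy) with decode σ-xy
  ... | w , refl = true ∷ w , refl
  decode (inj₂ refl ∷ σ-xy) with decode σ-xy
  ... | w , refl = false ∷ w , refl

  decode-around : ∀ α {u v} β → OverXY (α ++ u ∷ v ∷ β) →
                  Σ _ λ a → Σ _ λ b → α ≡ encode a × β ≡ encode b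
  decode-around α β αuvβ-xy with ++⁻ α αuvβ-xy
  ... | α-xy , _ ∷ _ ∷ β-xy with decode α-xy | decode β-xy
  ... | a , α≡ | b , β≡ = a , b , α≡ , β≡

  encode-xy : ∀ a b → encode (xy a b) ≡ encode a ++ x ∷ y ∷ encode b
  encode-xy a b = map-++ letter a (true ∷ false ∷ b)

  encode-yx : ∀ a b → encode (yx a b) ≡ encode a ++ y ∷ x ∷ encode b
  encode-yx a b = map-++ letter a (false ∷ true ∷ b)

  EncodedSwap : ReqSeq n → ReqSeq n → List Bool → List Bool → Set
  EncodedSwap σ σ′ a b = (σ ≡ encode (xy a b) × σ′ ≡ encode (yx a b))
                       ⊎ (σ ≡ encode (yx a b) × σ′ ≡ encode (xy a b))

  decode-adjSwap : ∀ {σ σ′ q l} → OverXY σ → AdjSwap σ σ′ x q y l →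
                   Σ _ λ a → Σ _ λ b → suc (#x a) ≡ q × suc (#y a) ≡ l × EncodedSwap σ σ′ a b
  decode-adjSwap σ-xy (α , β , q≡ , l≡ , σ≡σ′≡) with σ≡σ′≡
  ... | inj₁ (refl , refl) with decode-around α β σ-xy
  ...   | a , b , refl , refl =
          a , b , trans (cong suc (sym (occ-x-encode a))) q≡ ,
          trans (cong suc (sym (occ-y-encode a))) l≡ ,
          inj₁ (sym (encode-xy a b) , sym (encode-yx a b))
  decode-adjSwap σ-xy (α , β , q≡ , l≡ , σ≡σ′≡) | inj₂ (refl , refl) with decode-around α β σ-xy
  ...   | a , b , refl , refl =
          a , b , trans (cong suc (sym (occ-x-encode a))) q≡ ,
          trans (cong suc (sym (occ-y-encode a))) l≡ ,
          inj₂ (sym (encode-yx a b) , sym (encode-xy a b))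

  counts-encode : ∀ w → (occ x (encode w) , occ y (encode w)) ≡ counts w
  counts-encode w = cong₂ _,_ (occ-x-encode w) (occ-y-encode w)

  counts-encodedSwap : ∀ {σ σ′ a b} → EncodedSwap σ σ′ a b → (occ x σ , occ y σ) ≡ counts (xy a b)
  counts-encodedSwap {a = a} {b} (inj₁ (refl , refl)) = counts-encode (xy a b)
  counts-encodedSwap {a = a} {b} (inj₂ (refl , refl)) =
    trans (counts-encode (yx a b)) (sym (counts-swap a b))

module _ {n} (S : Algorithm n) {x y : Item n} (x≢y : x ≢ y) where
  open Encoding x≢y

  order : List Bool → Bool
  order w = Sxy S (encode w) x y

  agile⇔ : ∀ {σ σ′ a b} → EncodedSwap σ σ′ a b → (Sxy S σ x y ≢ Sxy S σ′ x y) ⇔ Agile order a b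
  agile⇔ (inj₁ (refl , refl)) = mk⇔ (λ ne → ne) (λ ne → ne)
  agile⇔ (inj₂ (refl , refl)) = mk⇔ ≢-sym ≢-sym

  agile⇒InR : ∀ {i j} a b → counts (xy a b) ≡ (i , j) → Agile order a b →
              InR S x i (suc (#x a)) × InR S y j (suc (#y a))
  agile⇒InR a b ij agile =
    (s≤s z≤n , subst (suc (#x a) ≤_) (cong proj₁ ij) (#x-< a b) ,
     y , suc (#y a) , encode (xy a b) , trans (occ-x-encode (xy a b)) (cong proj₁ ij) ,
     encode (yx a b) , swap-xy , agile) ,
    (s≤s z≤n , subst (suc (#y a) ≤_) (cong proj₂ ij) (#y-< a b) ,
     x , suc (#x a) , encode (xy a b) , trans (occ-y-encode (xy a b)) (cong proj₂ ij) ,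
     encode (yx a b) , swap-yx , agile ∘ flipped)
    where
    swap-xy : AdjSwap (encode (xy a b)) (encode (yx a b)) x (suc (#x a)) y (suc (#y a))
    swap-xy = encode a , encode b , cong suc (occ-x-encode a) , cong suc (occ-y-encode a) ,
              inj₁ (encode-xy a b , encode-yx a b)
    swap-yx : AdjSwap (encode (xy a b)) (encode (yx a b)) y (suc (#y a)) x (suc (#x a))
    swap-yx = encode a , encode b , cong suc (occ-y-encode a) , cong suc (occ-x-encode a) ,
              inj₂ (encode-xy a b , encode-yx a b)
    flipped : Sxy S (encode (xy a b)) y x ≡ Sxy S (encode (yx a b)) y x →
              order (xy a b) ≡ order (yx a b)
    flipped eq = not-injective (begin
      not (order (xy a b))             ≡⟨ Sxy-flip S _ x≢y ⟨
      Sxy S (encode (xy a b)) y x      ≡⟨ eq ⟩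
      Sxy S (encode (yx a b)) y x      ≡⟨ Sxy-flip S _ x≢y ⟩
      not (order (yx a b))             ∎)
      where open ≡-Reasoning

  agile-prefix-unique : ∀ {i j a b a′ b′} → CardR≡1 S x i → CardR≡1 S y j →
                        counts (xy a b) ≡ (i , j) → Agile order a b →
                        counts (xy a′ b′) ≡ (i , j) → Agile order a′ b′ → counts a ≡ counts a′
  agile-prefix-unique {a = a} {b} {a′} {b′} (_ , _ , x-unique) (_ , _ , y-unique) ij agile ij′ agile′
    with agile⇒InR a b ij agile | agile⇒InR a′ b′ ij′ agile′
  ... | x∈R , y∈R | x∈R′ , y∈R′ =
    cong₂ _,_ (suc-injective (trans (x-unique _ x∈R) (sym (x-unique _ x∈R′))))
              (suc-injective (trans (y-unique _ y∈R) (sym (y-unique _ y∈R′))))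

  swap-in-perm : ∀ {i j q l σ σ′} → InPerm x i y j σ → AdjSwap σ σ′ x q y l →
                 Σ _ λ a → Σ _ λ b → suc (#x a) ≡ q × suc (#y a) ≡ l × counts (xy a b) ≡ (i , j) ×
                 ((Sxy S σ x y ≢ Sxy S σ′ x y) ⇔ Agile order a b)
  swap-in-perm (σ-xy , σ-i , σ-j) swap with decode-adjSwap σ-xy swap
  ... | a , b , q≡ , l≡ , encoded =
    a , b , q≡ , l≡ , trans (sym (counts-encodedSwap encoded)) (cong₂ _,_ σ-i σ-j) , agile⇔ encoded

lemma9 : (n : ℕ) (S : Algorithm n) → Projective S →
    (x y : Item n) → x ≢ y → (i j q l : ℕ) →
    CardR≡1 S x i → CardR≡1 S y j →
    Σ (ReqSeq n) (λ lam → InPerm x i y j lam × AgilePair S lam x q y l) →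
    ∀ σ σ' → InPerm x i y j σ → AdjSwap σ σ' x q y l →
    Sxy S σ x y ≢ Sxy S σ' x y
lemma9 _ S _ x y x≢y i j q l R-x R-y (lam , lam-perm , lam′ , lam-swap , lam-agile) σ σ′ σ-perm σ-swap
  with swap-in-perm S x≢y lam-perm lam-swap | swap-in-perm S x≢y σ-perm σ-swap
... | a₀ , b₀ , refl , refl , ij₀ , agile⇔₀ | a , b , q≡ , l≡ , ij , agile⇔ =
  from agile⇔ (agile-transfer refl ij₀ agile₀ (cong₂ _,_ (suc-injective q≡) (suc-injective l≡)) ij)
  where
  open Equivalence
  agile₀ : Agile (order S x≢y) a₀ b₀
  agile₀ = to agile⇔₀ lam-agile
  swap-invariant : ∀ a′ b′ → counts (xy a′ b′) ≡ (i , j) → counts a′ ≢ counts a₀ →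
                   order S x≢y (xy a′ b′) ≡ order S x≢y (yx a′ b′)
  swap-invariant a′ b′ ij′ a′≢a₀ = decidable-stable (_ ≟ᵇ _) λ agile′ →
    a′≢a₀ (agile-prefix-unique S x≢y R-x R-y ij′ agile′ ij₀ agile₀)
  open AgileAtOnePrefix (order S x≢y) i j (counts a₀) swap-invariant
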